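{- Let $f=\sum_{P\in\mathcal{M}} x^P$ be a real polynomial in $x_1,\ldots,x_n$ with all coefficients in $\{0,1\}$ in the scaled monomial basis, where $\mathcal M$ is its set of exponent vectors, and let $k\ge 0$. With $M$ and $B=M^TM$ as defined below, $\mathrm{Tr}(B^2)\le |\mathcal{M}|^2\sum_{P\in\mathcal{M}}\binom{\sup(P)}{k}$.
   Context: For an $n$-tuple $\alpha$ of nonnegative integers, $x^\alpha$ denotes $x_1^{\alpha_1}\cdots x_n^{\alpha_n}/(\alpha_1!\cdots\alpha_n!)$. Write $f=\sum_\gamma a_\gamma x^\gamma$. $M$ is the matrix with rows indexed by $I\in\{0,1\}^n$ having exactly $k$ ones, columns indexed by $n$-tuples $J$ of nonnegative integers, and entries $M_{I,J}=a_{I+J}$. $\sup(P)$ is the number of nonzero coordinates of $P$. -}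

module Defs where

open import Data.Nat using (ℕ; zero; suc; _+_; _*_; _≟_)
open import Data.Bool using (if_then_else_)
open import Data.List using (List; []; _∷_; map; concatMap; upTo; filter; length)
open import Data.Nat.ListAction using (sum)
open import Data.Bool.ListAction using (any)
open import Data.Vec using (Vec; []; _∷_; zipWith; toList)
import Data.Vec.Properties as VP
open import Relation.Nullary.Decidable using (⌊_⌋)

Exp : ℕ → Set
Exp n = Vec ℕ n

box : (n D : ℕ) → List (Exp n)
box zero    D = [] ∷ []
box (suc n) D = concatMap (λ d → map (d ∷_) (box n D)) (upTo (suc D))

rows : (n k : ℕ) → List (Exp n)
rows n k = filter (λ v → Data.Vec.sum v ≟ k) (box n 1)
  where import Data.Vec

-- coefficient a_γ of f = Σ_{P ∈ 𝓜} x^P : 1 if γ ∈ 𝓜, else 0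
coeff : ∀ {n} → List (Exp n) → Exp n → ℕ
coeff 𝓜 γ = if any (λ P → ⌊ VP.≡-dec _≟_ γ P ⌋) 𝓜 then 1 else 0

-- a bound on all coordinates of all P ∈ 𝓜; every column J of M with a
-- nonzero entry satisfies J ≤ P for some P ∈ 𝓜, hence lies in box n (bound 𝓜)
bound : ∀ {n} → List (Exp n) → ℕ
bound 𝓜 = sum (map (λ P → sum (toList P)) 𝓜)

cols : ∀ {n} → List (Exp n) → List (Exp n)
cols {n} 𝓜 = box n (bound 𝓜)

Mat : ∀ {n} → List (Exp n) → Exp n → Exp n → ℕ
Mat 𝓜 I J = coeff 𝓜 (zipWith _+_ I J)

Bmat : ∀ {n} → ℕ → List (Exp n) → Exp n → Exp n → ℕ
Bmat {n} k 𝓜 J J' = sum (map (λ I → Mat 𝓜 I J * Mat 𝓜 I J') (rows n k))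

trB² : ∀ {n} → ℕ → List (Exp n) → ℕ
trB² k 𝓜 = sum (map (λ J → sum (map (λ J' → Bmat k 𝓜 J J' * Bmat k 𝓜 J' J) (cols 𝓜))) (cols 𝓜))

supp : ∀ {n} → Exp n → ℕ
supp []          = 0
supp (zero ∷ P)  = supp P
supp (suc _ ∷ P) = suc (supp P)

module Submission where

-- Since every coefficient of f is 0 or 1, M is a 0/1 matrix.  Its line sums
-- are bounded by L = |𝓜|: for fixed I (resp. J) and fixed P ∈ 𝓜 there is at
-- most one J (resp. I) with I + J = P.  For any 0/1 matrix whose row and
-- column sums are at most L, the Gram matrix B satisfies B_{J,J'} ≤ L, hence
--   Tr(B²) = Σ B_{J,J'}² ≤ L · Σ_{J,J'} B_{J,J'} = L · Σ_I r_I² ≤ L² · Σ_I r_I,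
-- where r_I is the I-th row sum (Gram.trace²-bound).  Finally Σ_I r_I, the
-- number of ones of M, is at most Σ_{P ∈ 𝓜} #{I ∈ {0,1}ⁿ : |I| = k, I ≤ P},
-- and that count is exactly C(sup(P), k) (rows-below≡C).

open import Defs
open import Data.Nat using (ℕ; _*_; _^_; _≤_)
open import Data.Nat.Combinatorics using (_C_)
open import Data.List using (List; map; length)
open import Data.Nat.ListAction using (sum)
open import Data.List.Relation.Unary.Unique.Propositional using (Unique)

open import Data.Nat using (zero; suc; _+_; _≟_; _≡ᵇ_; _≤ᵇ_; _<ᵇ_; z≤n; s≤s)
open import Data.Nat.Properties
open import Data.Nat.Combinatorics using (nCk+nC[k+1]≡[n+1]C[k+1])
open import Data.Nat.ListAction.Properties using (sum-++)
open import Data.Bool using (Bool; true; false; if_then_else_; _∧_)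
open import Data.Bool.Properties using (∧-zeroʳ)
open import Data.Bool.ListAction using (any)
open import Data.List using ([]; _∷_; _++_; concatMap; upTo; filter)
open import Data.List.Properties using (map-++; map-upTo)
open import Data.Vec using ([]; _∷_; zipWith)
import Data.Vec
import Data.Vec.Properties as VP
open import Relation.Nullary.Decidable using (Dec; does; ⌊_⌋; isYes≗does)
open import Relation.Binary.PropositionalEquality
open import Level using (Level)
open import Algebra.Properties.CommutativeSemigroup +-commutativeSemigroup using (interchange)

ind : Bool → ℕ
ind b = if b then 1 else 0

ind≤1 : ∀ b → ind b ≤ 1
ind≤1 true  = ≤-refl
ind≤1 false = z≤n

ind-∧ : ∀ a b → ind (a ∧ b) ≡ ind a * ind b
ind-∧ true  b = sym (*-identityˡ (ind b))
ind-∧ false b = refl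

private
  variable
    a b : Level
    A : Set a
    B : Set b

∑ : List A → (A → ℕ) → ℕ
∑ xs f = sum (map f xs)

syntax ∑ xs (λ x → e) = ∑[ x ∈ xs ] e

∑-cong : ∀ (xs : List A) {f g : A → ℕ} → (∀ x → f x ≡ g x) → ∑ xs f ≡ ∑ xs g
∑-cong []       eq = refl
∑-cong (x ∷ xs) eq = cong₂ _+_ (eq x) (∑-cong xs eq)

∑-mono : ∀ (xs : List A) {f g : A → ℕ} → (∀ x → f x ≤ g x) → ∑ xs f ≤ ∑ xs g
∑-mono []       le = z≤n
∑-mono (x ∷ xs) le = +-mono-≤ (le x) (∑-mono xs le)

∑-zero : ∀ (xs : List A) → ∑[ x ∈ xs ] 0 ≡ 0
∑-zero []       = refl
∑-zero (x ∷ xs) = ∑-zero xs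

∑-+ : ∀ (xs : List A) (f g : A → ℕ) → ∑[ x ∈ xs ] (f x + g x) ≡ ∑ xs f + ∑ xs g
∑-+ []       f g = refl
∑-+ (x ∷ xs) f g = trans (cong (f x + g x +_) (∑-+ xs f g))
                         (interchange (f x) (g x) (∑ xs f) (∑ xs g))

∑-*ˡ : ∀ (xs : List A) c (f : A → ℕ) → ∑[ x ∈ xs ] (c * f x) ≡ c * ∑ xs f
∑-*ˡ []       c f = sym (*-zeroʳ c)
∑-*ˡ (x ∷ xs) c f = trans (cong (c * f x +_) (∑-*ˡ xs c f)) (sym (*-distribˡ-+ c (f x) (∑ xs f)))

∑-*ʳ : ∀ (xs : List A) c (f : A → ℕ) → ∑[ x ∈ xs ] (f x * c) ≡ ∑ xs f * c
∑-*ʳ xs c f = trans (∑-cong xs (λ x → *-comm (f x) c)) (trans (∑-*ˡ xs c f) (*-comm c (∑ xs f)))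

∑-swap : (xs : List A) (ys : List B) (f : A → B → ℕ) →
         ∑[ x ∈ xs ] ∑[ y ∈ ys ] f x y ≡ ∑[ y ∈ ys ] ∑[ x ∈ xs ] f x y
∑-swap []       ys f = sym (∑-zero ys)
∑-swap (x ∷ xs) ys f = trans (cong (∑ ys (f x) +_) (∑-swap xs ys f))
                             (sym (∑-+ ys (f x) (λ y → ∑[ x' ∈ xs ] f x' y)))

∑-++ : ∀ (xs ys : List A) (f : A → ℕ) → ∑ (xs ++ ys) f ≡ ∑ xs f + ∑ ys f
∑-++ xs ys f = trans (cong sum (map-++ f xs ys)) (sum-++ (map f xs) (map f ys))

∑-map : (xs : List B) (g : B → A) (f : A → ℕ) →
        ∑ (map g xs) f ≡ ∑[ x ∈ xs ] f (g x)
∑-map []       g f = refl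
∑-map (x ∷ xs) g f = cong (f (g x) +_) (∑-map xs g f)

∑-concatMap : (xs : List B) (g : B → List A) (f : A → ℕ) →
              ∑ (concatMap g xs) f ≡ ∑[ x ∈ xs ] ∑ (g x) f
∑-concatMap []       g f = refl
∑-concatMap (x ∷ xs) g f = trans (∑-++ (g x) (concatMap g xs) f)
                                 (cong (∑ (g x) f +_) (∑-concatMap xs g f))

∑-≤-length : ∀ (xs : List A) (f : A → ℕ) → (∀ x → f x ≤ 1) → ∑ xs f ≤ length xs
∑-≤-length []       f le = z≤n
∑-≤-length (x ∷ xs) f le = +-mono-≤ (le x) (∑-≤-length xs f le)

∑-filter : ∀ {p} {P : A → Set p} (P? : ∀ x → Dec (P x)) (xs : List A) (f : A → ℕ) →
           ∑ (filter P? xs) f ≡ ∑[ x ∈ xs ] (if does (P? x) then f x else 0)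
∑-filter P? []       f = refl
∑-filter P? (x ∷ xs) f with does (P? x)
... | true  = cong (f x +_) (∑-filter P? xs f)
... | false = ∑-filter P? xs f

∑-filter≤ : ∀ {p} {P : A → Set p} (P? : ∀ x → Dec (P x)) (xs : List A) (f : A → ℕ) →
            ∑ (filter P? xs) f ≤ ∑ xs f
∑-filter≤ P? xs f = ≤-trans (≤-reflexive (∑-filter P? xs f)) (∑-mono xs gated≤)
  where
  gated≤ : ∀ x → (if does (P? x) then f x else 0) ≤ f x
  gated≤ x with does (P? x)
  ... | true  = ≤-refl
  ... | false = z≤n

ind-any≤∑ : ∀ (b : A → Bool) (xs : List A) → ind (any b xs) ≤ ∑[ x ∈ xs ] ind (b x)
ind-any≤∑ b []       = z≤n
ind-any≤∑ b (x ∷ xs) with b x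
... | true  = s≤s z≤n
... | false = ind-any≤∑ b xs

∑-upTo-suc : ∀ m (g : ℕ → ℕ) → ∑[ d ∈ upTo (suc m) ] g d ≡ g 0 + ∑[ d ∈ upTo m ] g (suc d)
∑-upTo-suc m g = cong (g 0 +_) (trans (cong (λ ds → ∑ ds g) (sym (map-upTo suc m)))
                                      (∑-map (upTo m) suc g))

_=ᵥ_ : ∀ {n} → Exp n → Exp n → Bool
X =ᵥ Y = does (VP.≡-dec _≟_ X Y)

_≤ᵥ_ : ∀ {n} → Exp n → Exp n → Bool
[]      ≤ᵥ []      = true
(x ∷ X) ≤ᵥ (y ∷ Y) = (x ≤ᵇ y) ∧ (X ≤ᵥ Y)

hit-or-later : ∀ i p → ind (i ≡ᵇ p) + ind (suc i ≤ᵇ p) ≤ ind (i ≤ᵇ p)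
hit-or-later zero    zero    = ≤-refl
hit-or-later zero    (suc p) = ≤-refl
hit-or-later (suc i) zero    = z≤n
hit-or-later (suc i) (suc p) =
  subst (λ b → ind (i ≡ᵇ p) + ind (suc i ≤ᵇ p) ≤ ind b) (≤ᵇ-as-<ᵇ i p) (hit-or-later i p)
  where
  ≤ᵇ-as-<ᵇ : ∀ i p → (i ≤ᵇ p) ≡ (i <ᵇ suc p)
  ≤ᵇ-as-<ᵇ zero    p = refl
  ≤ᵇ-as-<ᵇ (suc i) p = refl

shift-hits : ∀ m i p → ∑[ d ∈ upTo m ] ind (i + d ≡ᵇ p) ≤ ind (i ≤ᵇ p)
shift-hits zero    i p = z≤n
shift-hits (suc m) i p = begin
  ∑[ d ∈ upTo (suc m) ] ind (i + d ≡ᵇ p)                 ≡⟨ ∑-upTo-suc m (λ d → ind (i + d ≡ᵇ p)) ⟩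
  ind (i + 0 ≡ᵇ p) + ∑[ d ∈ upTo m ] ind (i + suc d ≡ᵇ p) ≡⟨ cong₂ _+_ (hit (+-identityʳ i))
                                                             (∑-cong (upTo m) (λ d → hit (+-suc i d))) ⟩
  ind (i ≡ᵇ p) + ∑[ d ∈ upTo m ] ind (suc i + d ≡ᵇ p)     ≤⟨ +-monoʳ-≤ (ind (i ≡ᵇ p)) (shift-hits m (suc i) p) ⟩
  ind (i ≡ᵇ p) + ind (suc i ≤ᵇ p)                         ≤⟨ hit-or-later i p ⟩
  ind (i ≤ᵇ p)                                            ∎
  where
  open ≤-Reasoning
  hit : ∀ {x y} → x ≡ y → ind (x ≡ᵇ p) ≡ ind (y ≡ᵇ p)
  hit = cong (λ z → ind (z ≡ᵇ p))

∑-box-suc : ∀ n D (f : Exp (suc n) → ℕ) →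
            ∑ (box (suc n) D) f ≡ ∑[ d ∈ upTo (suc D) ] ∑[ J ∈ box n D ] f (d ∷ J)
∑-box-suc n D f = trans (∑-concatMap (upTo (suc D)) (λ d → map (d ∷_) (box n D)) f)
                        (∑-cong (upTo (suc D)) (λ d → ∑-map (box n D) (d ∷_) f))

box-hits : ∀ n D (I P : Exp n) → ∑[ J ∈ box n D ] ind (zipWith _+_ I J =ᵥ P) ≤ ind (I ≤ᵥ P)
box-hits zero    D []      []      = ≤-refl
box-hits (suc n) D (i ∷ I) (p ∷ P) = begin
  ∑[ J ∈ box (suc n) D ] ind (zipWith _+_ (i ∷ I) J =ᵥ (p ∷ P))
    ≡⟨ ∑-box-suc n D (λ J → ind (zipWith _+_ (i ∷ I) J =ᵥ (p ∷ P))) ⟩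
  ∑[ d ∈ upTo (suc D) ] ∑[ J ∈ box n D ] ind ((i + d ≡ᵇ p) ∧ (zipWith _+_ I J =ᵥ P))
    ≡⟨ ∑-cong (upTo (suc D)) (λ d → trans (∑-cong (box n D) (λ J → ind-∧ (i + d ≡ᵇ p) _))
                                          (∑-*ˡ (box n D) (ind (i + d ≡ᵇ p)) _)) ⟩
  ∑[ d ∈ upTo (suc D) ] (ind (i + d ≡ᵇ p) * rest)
    ≤⟨ ∑-mono (upTo (suc D)) (λ d → *-monoʳ-≤ (ind (i + d ≡ᵇ p)) (box-hits n D I P)) ⟩
  ∑[ d ∈ upTo (suc D) ] (ind (i + d ≡ᵇ p) * ind (I ≤ᵥ P))
    ≡⟨ ∑-*ʳ (upTo (suc D)) (ind (I ≤ᵥ P)) (λ d → ind (i + d ≡ᵇ p)) ⟩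
  (∑[ d ∈ upTo (suc D) ] ind (i + d ≡ᵇ p)) * ind (I ≤ᵥ P)
    ≤⟨ *-monoˡ-≤ (ind (I ≤ᵥ P)) (shift-hits (suc D) i p) ⟩
  ind (i ≤ᵇ p) * ind (I ≤ᵥ P)
    ≡⟨ ind-∧ (i ≤ᵇ p) (I ≤ᵥ P) ⟨
  ind ((i ∷ I) ≤ᵥ (p ∷ P))
    ∎
  where
  open ≤-Reasoning
  rest = ∑[ J ∈ box n D ] ind (zipWith _+_ I J =ᵥ P)

below : ∀ n → ℕ → Exp n → ℕ
below n k P = ∑[ I ∈ box n 1 ] ind ((I ≤ᵥ P) ∧ (Data.Vec.sum I ≡ᵇ k))

-- Pascal's rule: a zero coordinate of P forces I to vanish there; a nonzero
-- one lets I take either value, splitting the count as C(s, k) + C(s, k - 1).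
below≡C : ∀ n k (P : Exp n) → below n k P ≡ supp P C k
below≡C zero    zero    []          = refl
below≡C zero    (suc k) []          = refl
below≡C (suc n) k       (zero ∷ P)  = begin
  below (suc n) k (zero ∷ P)            ≡⟨ ∑-box-suc n 1 _ ⟩
  below n k P + (∑[ I ∈ box n 1 ] 0 + 0) ≡⟨ cong (λ z → below n k P + (z + 0)) (∑-zero (box n 1)) ⟩
  below n k P + 0                        ≡⟨ +-identityʳ _ ⟩
  below n k P                            ≡⟨ below≡C n k P ⟩
  supp P C k                             ∎
  where open ≡-Reasoning
below≡C (suc n) zero    (suc p ∷ P) = begin
  below (suc n) zero (suc p ∷ P)
    ≡⟨ ∑-box-suc n 1 _ ⟩
  below n zero P + (∑[ I ∈ box n 1 ] ind ((I ≤ᵥ P) ∧ false) + 0)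
    ≡⟨ cong (λ z → below n zero P + (z + 0))
            (trans (∑-cong (box n 1) (λ I → cong ind (∧-zeroʳ (I ≤ᵥ P)))) (∑-zero (box n 1))) ⟩
  below n zero P + 0
    ≡⟨ +-identityʳ _ ⟩
  below n zero P
    ≡⟨ below≡C n zero P ⟩
  supp P C zero
    ∎
  where open ≡-Reasoning
below≡C (suc n) (suc k) (suc p ∷ P) = begin
  below (suc n) (suc k) (suc p ∷ P)       ≡⟨ ∑-box-suc n 1 _ ⟩
  below n (suc k) P + (below n k P + 0)   ≡⟨ cong₂ (λ x y → x + (y + 0)) (below≡C n (suc k) P) (below≡C n k P) ⟩
  supp P C suc k + (supp P C k + 0)       ≡⟨ cong (supp P C suc k +_) (+-identityʳ _) ⟩
  supp P C suc k + supp P C k             ≡⟨ +-comm (supp P C suc k) (supp P C k) ⟩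
  supp P C k + supp P C suc k             ≡⟨ nCk+nC[k+1]≡[n+1]C[k+1] (supp P) k ⟩
  suc (supp P) C suc k                    ∎
  where open ≡-Reasoning

rows-below≡C : ∀ n k (P : Exp n) → ∑[ I ∈ rows n k ] ind (I ≤ᵥ P) ≡ supp P C k
rows-below≡C n k P = trans (∑-filter (λ v → Data.Vec.sum v ≟ k) (box n 1) (λ I → ind (I ≤ᵥ P)))
                           (trans (∑-cong (box n 1) (λ I → gate (I ≤ᵥ P) (Data.Vec.sum I ≡ᵇ k)))
                                  (below≡C n k P))
  where
  gate : ∀ a b → (if b then ind a else 0) ≡ ind (a ∧ b)
  gate true  b     = refl
  gate false true  = refl
  gate false false = refl

module Gram {Row : Set a} {Col : Set b} (rs : List Row) (cs : List Col) (M : Row → Col → ℕ) where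

  gram : Col → Col → ℕ
  gram J J' = ∑[ I ∈ rs ] (M I J * M I J')

  rowSum : Row → ℕ
  rowSum I = ∑[ J ∈ cs ] M I J

  gram-sym : ∀ J J' → gram J' J ≡ gram J J'
  gram-sym J J' = ∑-cong rs (λ I → *-comm (M I J') (M I J))

  ∑gram≡∑rowSum² : ∑[ J ∈ cs ] ∑[ J' ∈ cs ] gram J J' ≡ ∑[ I ∈ rs ] (rowSum I * rowSum I)
  ∑gram≡∑rowSum² = begin
    ∑[ J ∈ cs ] ∑[ J' ∈ cs ] ∑[ I ∈ rs ] (M I J * M I J')
      ≡⟨ ∑-cong cs (λ J → ∑-swap cs rs (λ J' I → M I J * M I J')) ⟩
    ∑[ J ∈ cs ] ∑[ I ∈ rs ] ∑[ J' ∈ cs ] (M I J * M I J')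
      ≡⟨ ∑-swap cs rs (λ J I → ∑[ J' ∈ cs ] (M I J * M I J')) ⟩
    ∑[ I ∈ rs ] ∑[ J ∈ cs ] ∑[ J' ∈ cs ] (M I J * M I J')
      ≡⟨ ∑-cong rs (λ I → ∑-cong cs (λ J → ∑-*ˡ cs (M I J) (M I))) ⟩
    ∑[ I ∈ rs ] ∑[ J ∈ cs ] (M I J * rowSum I)
      ≡⟨ ∑-cong rs (λ I → ∑-*ʳ cs (rowSum I) (M I)) ⟩
    ∑[ I ∈ rs ] (rowSum I * rowSum I)
      ∎
    where open ≡-Reasoning

  module _ (L : ℕ) (entry≤1 : ∀ I J → M I J ≤ 1)
           (rowSum≤ : ∀ I → rowSum I ≤ L) (colSum≤ : ∀ J → ∑[ I ∈ rs ] M I J ≤ L) where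

    -- Each entry of MᵀM is at most the corresponding column sum of M.
    gram≤ : ∀ J J' → gram J J' ≤ L
    gram≤ J J' = ≤-trans (∑-mono rs entry-product≤) (colSum≤ J)
      where
      entry-product≤ : ∀ I → M I J * M I J' ≤ M I J
      entry-product≤ I = ≤-trans (*-monoʳ-≤ (M I J) (entry≤1 I J')) (≤-reflexive (*-identityʳ (M I J)))

    trace²-bound : ∑[ J ∈ cs ] ∑[ J' ∈ cs ] (gram J J' * gram J' J) ≤ L ^ 2 * ∑[ I ∈ rs ] rowSum I
    trace²-bound = begin
      ∑[ J ∈ cs ] ∑[ J' ∈ cs ] (gram J J' * gram J' J)
        ≡⟨ ∑-cong cs (λ J → ∑-cong cs (λ J' → cong (gram J J' *_) (gram-sym J J'))) ⟩
      ∑[ J ∈ cs ] ∑[ J' ∈ cs ] (gram J J' * gram J J')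
        ≤⟨ ∑-mono cs (λ J → ∑-mono cs (λ J' → *-monoˡ-≤ (gram J J') (gram≤ J J'))) ⟩
      ∑[ J ∈ cs ] ∑[ J' ∈ cs ] (L * gram J J')
        ≡⟨ trans (∑-cong cs (λ J → ∑-*ˡ cs L (gram J))) (∑-*ˡ cs L _) ⟩
      L * ∑[ J ∈ cs ] ∑[ J' ∈ cs ] gram J J'
        ≡⟨ cong (L *_) ∑gram≡∑rowSum² ⟩
      L * ∑[ I ∈ rs ] (rowSum I * rowSum I)
        ≤⟨ *-monoʳ-≤ L (∑-mono rs (λ I → *-monoˡ-≤ (rowSum I) (rowSum≤ I))) ⟩
      L * ∑[ I ∈ rs ] (L * rowSum I)
        ≡⟨ cong (L *_) (∑-*ˡ rs L rowSum) ⟩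
      L * (L * ∑[ I ∈ rs ] rowSum I)
        ≡⟨ *-assoc L L _ ⟨
      L * L * ∑[ I ∈ rs ] rowSum I
        ≡⟨ cong (λ z → L * z * ∑[ I ∈ rs ] rowSum I) (*-identityʳ L) ⟨
      L ^ 2 * ∑[ I ∈ rs ] rowSum I
        ∎
      where open ≤-Reasoning

module Coefficients {n : ℕ} (𝓜 : List (Exp n)) where

  Mat≤hits : ∀ I J → Mat 𝓜 I J ≤ ∑[ P ∈ 𝓜 ] ind (zipWith _+_ I J =ᵥ P)
  Mat≤hits I J = ≤-trans (ind-any≤∑ (λ P → ⌊ VP.≡-dec _≟_ (zipWith _+_ I J) P ⌋) 𝓜)
                         (≤-reflexive (∑-cong 𝓜 (λ P → cong ind (isYes≗does (VP.≡-dec _≟_ (zipWith _+_ I J) P)))))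

  entry≤1 : ∀ I J → Mat 𝓜 I J ≤ 1
  entry≤1 I J = ind≤1 (any (λ P → ⌊ VP.≡-dec _≟_ (zipWith _+_ I J) P ⌋) 𝓜)

  Mat-comm : ∀ I J → Mat 𝓜 I J ≡ Mat 𝓜 J I
  Mat-comm I J = cong (coeff 𝓜) (VP.zipWith-comm +-comm I J)

  boxSum≤ : ∀ D I → ∑[ J ∈ box n D ] Mat 𝓜 I J ≤ length 𝓜
  boxSum≤ D I = begin
    ∑[ J ∈ box n D ] Mat 𝓜 I J
      ≤⟨ ∑-mono (box n D) (Mat≤hits I) ⟩
    ∑[ J ∈ box n D ] ∑[ P ∈ 𝓜 ] ind (zipWith _+_ I J =ᵥ P)
      ≡⟨ ∑-swap (box n D) 𝓜 _ ⟩
    ∑[ P ∈ 𝓜 ] ∑[ J ∈ box n D ] ind (zipWith _+_ I J =ᵥ P)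
      ≤⟨ ∑-≤-length 𝓜 _ (λ P → ≤-trans (box-hits n D I P) (ind≤1 (I ≤ᵥ P))) ⟩
    length 𝓜
      ∎
    where open ≤-Reasoning

  colSum≤ : ∀ k J → ∑[ I ∈ rows n k ] Mat 𝓜 I J ≤ length 𝓜
  colSum≤ k J = begin
    ∑[ I ∈ rows n k ] Mat 𝓜 I J ≤⟨ ∑-filter≤ (λ v → Data.Vec.sum v ≟ k) (box n 1) (λ I → Mat 𝓜 I J) ⟩
    ∑[ I ∈ box n 1 ] Mat 𝓜 I J  ≡⟨ ∑-cong (box n 1) (λ I → Mat-comm I J) ⟩
    ∑[ I ∈ box n 1 ] Mat 𝓜 J I  ≤⟨ boxSum≤ 1 J ⟩
    length 𝓜                    ∎
    where open ≤-Reasoning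

  ones≤ : ∀ k → ∑[ I ∈ rows n k ] ∑[ J ∈ cols 𝓜 ] Mat 𝓜 I J ≤ ∑[ P ∈ 𝓜 ] (supp P C k)
  ones≤ k = begin
    ∑[ I ∈ rows n k ] ∑[ J ∈ cols 𝓜 ] Mat 𝓜 I J
      ≤⟨ ∑-mono (rows n k) (λ I → ∑-mono (cols 𝓜) (Mat≤hits I)) ⟩
    ∑[ I ∈ rows n k ] ∑[ J ∈ cols 𝓜 ] ∑[ P ∈ 𝓜 ] ind (zipWith _+_ I J =ᵥ P)
      ≡⟨ ∑-cong (rows n k) (λ I → ∑-swap (cols 𝓜) 𝓜 _) ⟩
    ∑[ I ∈ rows n k ] ∑[ P ∈ 𝓜 ] ∑[ J ∈ cols 𝓜 ] ind (zipWith _+_ I J =ᵥ P)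
      ≤⟨ ∑-mono (rows n k) (λ I → ∑-mono 𝓜 (box-hits n (bound 𝓜) I)) ⟩
    ∑[ I ∈ rows n k ] ∑[ P ∈ 𝓜 ] ind (I ≤ᵥ P)
      ≡⟨ ∑-swap (rows n k) 𝓜 _ ⟩
    ∑[ P ∈ 𝓜 ] ∑[ I ∈ rows n k ] ind (I ≤ᵥ P)
      ≡⟨ ∑-cong 𝓜 (rows-below≡C n k) ⟩
    ∑[ P ∈ 𝓜 ] (supp P C k)
      ∎
    where open ≤-Reasoning

lemma3 : (n k : ℕ) (𝓜 : List (Exp n)) → Unique 𝓜 →
    trB² k 𝓜 ≤ (length 𝓜 ^ 2) * sum (map (λ P → supp P C k) 𝓜)
lemma3 n k 𝓜 _ = ≤-trans
  (trace²-bound (length 𝓜) entry≤1 (boxSum≤ (bound 𝓜)) (colSum≤ k))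
  (*-monoʳ-≤ (length 𝓜 ^ 2) (ones≤ k))
  where
  open Coefficients 𝓜
  open Gram (rows n k) (cols 𝓜) (Mat 𝓜)
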